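{- Let $t$ be a $\lambda$-term. Then there exist a typing environment $\Gamma$ and a type $\sigma$ with $\Gamma\vdash_{\mathcal S_w} t:\sigma$ if and only if $t$ is strongly normalizing (every $\beta$-reduction sequence starting from $t$ is finite).
   Context: $\lambda$-terms $t::=x\mid\lambda x.t\mid tu$; $\beta$-reduction is the contextual closure of $(\lambda x.t)u\to t\{u/x\}$. Types: $\sigma,\tau,\rho::=\alpha\mid A\to\tau$, $\alpha$ base types, multiset types $A=[\sigma_i]_{i\in I}$ finite possibly empty multisets ($[\,]$ empty). Environments $\Gamma$ map variables to multiset types, all but finitely many to $[\,]$; $\mathrm{dom}(\Gamma)=\{y:\Gamma(y)\ne[\,]\}$; $(\Gamma+\Delta)(y)=\Gamma(y)\uplus\Delta(y)$; $\Gamma\setminus y$ sets $y$ to $[\,]$; $\Gamma,x{:}A$ extends $\Gamma$ by mapping $x\notin\mathrm{dom}(\Gamma)$ to $A$. System $\mathcal S_w$: (var$_w$) $\Gamma,x{:}[\rho_1,\dots,\rho_n]\vdash x:\rho_i$ for $1\le i\le n$; ($\to$I) from $\Gamma\vdash t:\tau$ infer $\Gamma\setminus x\vdash\lambda x.t:\Gamma(x)\to\tau$; ($\to$E$_{\ne[]}$) from $\Gamma\vdash t:A\to\tau$, $\Delta\vdash u:A$, $A\ne[\,]$, infer $\Gamma+\Delta\vdash tu:\tau$; ($\to$E$_{[]}$) from $\Gamma\vdash t:[\,]\to\tau$ and $\Delta\vdash u:[\sigma]$ infer $\Gamma+\Delta\vdash tu:\tau$; (m) from $(\Delta_i\vdash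 t:\sigma_i)_{i\in I}$ ($I$ finite, possibly empty) infer $+_{i\in I}\Delta_i\vdash t:[\sigma_i]_{i\in I}$. -}

module Defs where

open import Data.Nat using (ℕ; zero; suc)
open import Data.List using (List; []; _∷_; _++_)
open import Data.List.Membership.Propositional using (_∈_)
open import Relation.Binary.PropositionalEquality using (_≡_)
open import Relation.Nullary using (¬_)

-- λ-terms (de Bruijn indices; variable n refers to the n-th enclosing binder,
-- or to free variable n - (number of binders) when free)

data Term : Set where
  var : ℕ → Term
  ƛ_  : Term → Term
  _·_ : Term → Term → Term

infixl 7 _·_
infix  6 ƛ_

ext : (ℕ → ℕ) → ℕ → ℕ
ext ρ zero    = zero
ext ρ (suc n) = suc (ρ n)

rename : (ℕ → ℕ) → Term → Term
rename ρ (var n) = var (ρ n)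
rename ρ (ƛ t)   = ƛ rename (ext ρ) t
rename ρ (t · u) = rename ρ t · rename ρ u

exts : (ℕ → Term) → ℕ → Term
exts σ zero    = var zero
exts σ (suc n) = rename suc (σ n)

subst : (ℕ → Term) → Term → Term
subst σ (var n) = σ n
subst σ (ƛ t)   = ƛ subst (exts σ) t
subst σ (t · u) = subst σ t · subst σ u

-- single substitution  t{u/0}  (free variables above 0 are decremented)
sub0 : Term → ℕ → Term
sub0 u zero    = u
sub0 u (suc n) = var n

_[_] : Term → Term → Term
t [ u ] = subst (sub0 u) t

infix 4 _⟶β_
data _⟶β_ : Term → Term → Set where
  β   : ∀ {t u}    → (ƛ t) · u ⟶β t [ u ]
  ξƛ  : ∀ {t t'}   → t ⟶β t' → ƛ t ⟶β ƛ t'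
  ξ·₁ : ∀ {t t' u} → t ⟶β t' → t · u ⟶β t' · u
  ξ·₂ : ∀ {t u u'} → u ⟶β u' → t · u ⟶β t · u'

data SN (t : Term) : Set where
  sn : (∀ {t'} → t ⟶β t' → SN t') → SN t

-- Types:  σ ::= α | A → σ,   A a finite multiset of types.
-- Multisets are represented by lists; multiset equality is the
-- (recursive) permutation equivalence _≈M_ below.

data Ty : Set where
  base : ℕ → Ty
  _⇒_  : List Ty → Ty → Ty

MTy : Set
MTy = List Ty

infix 4 _≈T_ _≈M_
data _≈T_ : Ty → Ty → Set
data _≈M_ : MTy → MTy → Set

data _≈T_ where
  base : ∀ {a} → base a ≈T base a
  arr  : ∀ {A B σ τ} → A ≈M B → σ ≈T τ → (A ⇒ σ) ≈T (B ⇒ τ)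

data _≈M_ where
  []    : [] ≈M []
  _∷_   : ∀ {σ τ A B} → σ ≈T τ → A ≈M B → (σ ∷ A) ≈M (τ ∷ B)
  swap  : ∀ {σ τ A} → (σ ∷ τ ∷ A) ≈M (τ ∷ σ ∷ A)
  trans : ∀ {A B C} → A ≈M B → B ≈M C → A ≈M C

-- Environments: finite-support maps from variables to multiset types,
-- represented as lists (position n = variable n; beyond the list = [ ]).

Env : Set
Env = List MTy

lookupE : Env → ℕ → MTy
lookupE []      n       = []
lookupE (A ∷ Γ) zero    = A
lookupE (A ∷ Γ) (suc n) = lookupE Γ n

headE : Env → MTy
headE []      = []
headE (A ∷ Γ) = A

tailE : Env → Env
tailE []      = []
tailE (A ∷ Γ) = Γ

_+E_ : Env → Env → Env
[]      +E Δ       = Δ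
(A ∷ Γ) +E []      = A ∷ Γ
(A ∷ Γ) +E (B ∷ Δ) = (A ++ B) ∷ (Γ +E Δ)

infix 3 _⊢_∶_ _⊢m_∶_
data _⊢_∶_  : Env → Term → Ty → Set
data _⊢m_∶_ : Env → Term → MTy → Set

data _⊢_∶_ where
  varw  : ∀ {Γ n ρ} → ρ ∈ lookupE Γ n → Γ ⊢ var n ∶ ρ
  lam   : ∀ {Γ t τ} → Γ ⊢ t ∶ τ → tailE Γ ⊢ ƛ t ∶ (headE Γ ⇒ τ)
  app≠  : ∀ {Γ Δ t u A B τ} → Γ ⊢ t ∶ (A ⇒ τ) → Δ ⊢m u ∶ B → A ≈M B →
          ¬ (A ≡ []) → Γ +E Δ ⊢ t · u ∶ τ
  app[] : ∀ {Γ Δ t u σ τ} → Γ ⊢ t ∶ ([] ⇒ τ) → Δ ⊢m u ∶ (σ ∷ []) →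
          Γ +E Δ ⊢ t · u ∶ τ

data _⊢m_∶_ where
  mnil  : ∀ {t} → [] ⊢m t ∶ []
  mcons : ∀ {Γ Δ t σ A} → Γ ⊢ t ∶ σ → Δ ⊢m t ∶ A → Γ +E Δ ⊢m t ∶ (σ ∷ A)

-- Soundness is the Tait–Girard reducibility argument: a type is read as a set
-- of strongly normalising terms closed under reduction and under expansion of
-- neutral terms, and a multiset type as the intersection of its members.
-- Completeness is by induction on a strongly normalising t, covering all of
-- its subterms: an application whose head is a variable is typable at every
-- type, and one whose head is a redex inherits the types of its contractum by
-- subject expansion.  Subject expansion holds in S_w because the variable x of
-- (λx.b)c is given exactly the types at which c is substituted in b[c/x], and
-- when there are none, (→E_[]) still accepts c at whatever type c has.
module Submission where

open import Defs
open import Data.Product using (Σ)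
open import Function.Bundles using (_⇔_)

open import Data.Nat using (ℕ; zero; suc)
open import Data.List using ([]; _∷_; _++_)
open import Data.List.Membership.Propositional using (_∈_)
open import Data.List.Relation.Unary.Any using (here; there)
open import Data.List.Relation.Unary.All using (All; []; _∷_)
open import Data.List.Relation.Unary.All.Properties using (++⁺)
open import Data.List.Properties using (++-identityʳ)
open import Data.Product using (_×_; _,_; proj₁; proj₂)
open import Data.Product.Function.NonDependent.Propositional using (_×-⇔_)
open import Data.Sum using (_⊎_; inj₁; inj₂)
open import Data.Unit using (⊤; tt)
open import Data.Empty using (⊥-elim)
open import Function using (_∘_)
open import Function.Bundles using (mk⇔; Equivalence)
import Function.Properties.Equivalence as ⇔
open import Relation.Nullary using (¬_)
open import Relation.Binary.PropositionalEquality
  using (_≡_; _≗_; refl; sym; cong; cong₂; module ≡-Reasoning)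
  renaming (subst to transport)
import Relation.Binary.PropositionalEquality as ≡

open Equivalence using (to; from)

-- Renaming and substitution

ext-cong : ∀ {f g} → f ≗ g → ext f ≗ ext g
ext-cong f≗g zero    = refl
ext-cong f≗g (suc n) = cong suc (f≗g n)

rename-cong : ∀ {f g} → f ≗ g → ∀ t → rename f t ≡ rename g t
rename-cong f≗g (var n) = cong var (f≗g n)
rename-cong f≗g (ƛ t)   = cong ƛ_ (rename-cong (ext-cong f≗g) t)
rename-cong f≗g (t · u) = cong₂ _·_ (rename-cong f≗g t) (rename-cong f≗g u)

exts-cong : ∀ {s s'} → s ≗ s' → exts s ≗ exts s'
exts-cong s≗s' zero    = refl
exts-cong s≗s' (suc n) = cong (rename suc) (s≗s' n)

subst-cong : ∀ {s s'} → s ≗ s' → ∀ t → subst s t ≡ subst s' t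
subst-cong s≗s' (var n) = s≗s' n
subst-cong s≗s' (ƛ t)   = cong ƛ_ (subst-cong (exts-cong s≗s') t)
subst-cong s≗s' (t · u) = cong₂ _·_ (subst-cong s≗s' t) (subst-cong s≗s' u)

ext-∘ : ∀ f g → ext f ∘ ext g ≗ ext (f ∘ g)
ext-∘ f g zero    = refl
ext-∘ f g (suc n) = refl

rename-rename : ∀ f g t → rename f (rename g t) ≡ rename (f ∘ g) t
rename-rename f g (var n) = refl
rename-rename f g (ƛ t)   =
  cong ƛ_ (≡.trans (rename-rename (ext f) (ext g) t) (rename-cong (ext-∘ f g) t))
rename-rename f g (t · u) = cong₂ _·_ (rename-rename f g t) (rename-rename f g u)

exts-ext : ∀ s f → exts s ∘ ext f ≗ exts (s ∘ f)
exts-ext s f zero    = refl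
exts-ext s f (suc n) = refl

subst-rename : ∀ s f t → subst s (rename f t) ≡ subst (s ∘ f) t
subst-rename s f (var n) = refl
subst-rename s f (ƛ t)   =
  cong ƛ_ (≡.trans (subst-rename (exts s) (ext f) t) (subst-cong (exts-ext s f) t))
subst-rename s f (t · u) = cong₂ _·_ (subst-rename s f t) (subst-rename s f u)

ext-exts : ∀ f s → rename (ext f) ∘ exts s ≗ exts (rename f ∘ s)
ext-exts f s zero    = refl
ext-exts f s (suc n) =
  ≡.trans (rename-rename (ext f) suc (s n)) (sym (rename-rename suc f (s n)))

rename-subst : ∀ f s t → rename f (subst s t) ≡ subst (rename f ∘ s) t
rename-subst f s (var n) = refl
rename-subst f s (ƛ t)   =
  cong ƛ_ (≡.trans (rename-subst (ext f) (exts s) t) (subst-cong (ext-exts f s) t))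
rename-subst f s (t · u) = cong₂ _·_ (rename-subst f s t) (rename-subst f s u)

exts-exts : ∀ s₂ s₁ → subst (exts s₂) ∘ exts s₁ ≗ exts (subst s₂ ∘ s₁)
exts-exts s₂ s₁ zero    = refl
exts-exts s₂ s₁ (suc n) =
  ≡.trans (subst-rename (exts s₂) suc (s₁ n)) (sym (rename-subst suc s₂ (s₁ n)))

subst-subst : ∀ s₂ s₁ t → subst s₂ (subst s₁ t) ≡ subst (subst s₂ ∘ s₁) t
subst-subst s₂ s₁ (var n) = refl
subst-subst s₂ s₁ (ƛ t)   =
  cong ƛ_ (≡.trans (subst-subst (exts s₂) (exts s₁) t) (subst-cong (exts-exts s₂ s₁) t))
subst-subst s₂ s₁ (t · u) = cong₂ _·_ (subst-subst s₂ s₁ t) (subst-subst s₂ s₁ u)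

exts-var : exts var ≗ var
exts-var zero    = refl
exts-var (suc n) = refl

subst-var : ∀ t → subst var t ≡ t
subst-var (var n) = refl
subst-var (ƛ t)   = cong ƛ_ (≡.trans (subst-cong exts-var t) (subst-var t))
subst-var (t · u) = cong₂ _·_ (subst-var t) (subst-var u)

rename-suc-[] : ∀ t u → rename suc t [ u ] ≡ t
rename-suc-[] t u = ≡.trans (subst-rename (sub0 u) suc t) (subst-var t)

infixr 5 _•_
_•_ : Term → (ℕ → Term) → ℕ → Term
(u • s) zero    = u
(u • s) (suc n) = s n

subst-exts-[] : ∀ s t u → subst (exts s) t [ u ] ≡ subst (u • s) t
subst-exts-[] s t u = ≡.trans (subst-subst (sub0 u) (exts s) t) (subst-cong cons t)
  where
  cons : subst (sub0 u) ∘ exts s ≗ u • s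
  cons zero    = refl
  cons (suc n) = rename-suc-[] (s n) u

subst-[] : ∀ s t u → subst s (t [ u ]) ≡ subst (exts s) t [ subst s u ]
subst-[] s t u = begin
  subst s (t [ u ])                              ≡⟨ subst-subst s (sub0 u) t ⟩
  subst (subst s ∘ sub0 u) t                     ≡⟨ subst-cong commute t ⟩
  subst (subst (sub0 (subst s u)) ∘ exts s) t    ≡⟨ sym (subst-subst _ (exts s) t) ⟩
  subst (exts s) t [ subst s u ]                 ∎
  where
  open ≡-Reasoning
  commute : subst s ∘ sub0 u ≗ subst (sub0 (subst s u)) ∘ exts s
  commute zero    = refl
  commute (suc n) = sym (rename-suc-[] (s n) (subst s u))

subst-⟶β : ∀ s {t t'} → t ⟶β t' → subst s t ⟶β subst s t'
subst-⟶β s (β {t} {u})  = transport (subst s ((ƛ t) · u) ⟶β_) (sym (subst-[] s t u)) β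
subst-⟶β s (ξƛ t⟶t')   = ξƛ (subst-⟶β (exts s) t⟶t')
subst-⟶β s (ξ·₁ t⟶t')  = ξ·₁ (subst-⟶β s t⟶t')
subst-⟶β s (ξ·₂ u⟶u')  = ξ·₂ (subst-⟶β s u⟶u')

-- Environments

lookupE-tailE : ∀ Γ n → lookupE (tailE Γ) n ≡ lookupE Γ (suc n)
lookupE-tailE []      n = refl
lookupE-tailE (A ∷ Γ) n = refl

headE-lookupE : ∀ Γ → headE Γ ≡ lookupE Γ 0
headE-lookupE []      = refl
headE-lookupE (A ∷ Γ) = refl

lookupE-+E : ∀ Γ Δ n → lookupE (Γ +E Δ) n ≡ lookupE Γ n ++ lookupE Δ n
lookupE-+E []      Δ       n       = refl
lookupE-+E (A ∷ Γ) []      n       = sym (++-identityʳ _)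
lookupE-+E (A ∷ Γ) (B ∷ Δ) zero    = refl
lookupE-+E (A ∷ Γ) (B ∷ Δ) (suc n) = lookupE-+E Γ Δ n

-- Reducibility

SN-var : ∀ n → SN (var n)
SN-var n = sn λ ()

SN-·ˡ : ∀ {t u} → SN (t · u) → SN t
SN-·ˡ (sn h) = sn λ t⟶t' → SN-·ˡ (h (ξ·₁ t⟶t'))

SN-[]⁻ : ∀ t {u} → SN (t [ u ]) → SN t
SN-[]⁻ t {u} (sn h) = sn λ {t'} t⟶t' → SN-[]⁻ t' (h (subst-⟶β (sub0 u) t⟶t'))

-- The argument u ranges over strongly normalising terms even when A = [],
-- which is what makes the rule (→E_[]) sound.
mutual
  Red : Ty → Term → Set
  Red (base a) t = SN t
  Red (A ⇒ τ)  t = ∀ u → SN u → Redᴹ A u → Red τ (t · u)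

  Redᴹ : MTy → Term → Set
  Redᴹ []      u = ⊤
  Redᴹ (σ ∷ A) u = Red σ u × Redᴹ A u

Redᴹ-∈ : ∀ {ρ A u} → ρ ∈ A → Redᴹ A u → Red ρ u
Redᴹ-∈ (here refl) (r , _)  = r
Redᴹ-∈ (there ρ∈A) (_ , rs) = Redᴹ-∈ ρ∈A rs

Redᴹ-++⁻ : ∀ A {B u} → Redᴹ (A ++ B) u → Redᴹ A u × Redᴹ B u
Redᴹ-++⁻ []      rs       = tt , rs
Redᴹ-++⁻ (σ ∷ A) (r , rs) = let ra , rb = Redᴹ-++⁻ A rs in (r , ra) , rb

mutual
  Red-≈T : ∀ {σ τ t} → σ ≈T τ → Red σ t ⇔ Red τ t
  Red-≈T base          = ⇔.refl
  Red-≈T (arr A≈B σ≈τ) = mk⇔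
    (λ f u su rb → to   (Red-≈T σ≈τ) (f u su (from (Redᴹ-≈M A≈B) rb)))
    (λ f u su ra → from (Red-≈T σ≈τ) (f u su (to   (Redᴹ-≈M A≈B) ra)))

  Redᴹ-≈M : ∀ {A B u} → A ≈M B → Redᴹ A u ⇔ Redᴹ B u
  Redᴹ-≈M []              = ⇔.refl
  Redᴹ-≈M (σ≈τ ∷ A≈B)     = Red-≈T σ≈τ ×-⇔ Redᴹ-≈M A≈B
  Redᴹ-≈M swap            = mk⇔ (λ (a , b , c) → b , a , c) (λ (a , b , c) → b , a , c)
  Redᴹ-≈M (trans A≈B B≈C) = ⇔.trans (Redᴹ-≈M A≈B) (Redᴹ-≈M B≈C)

mutual
  Red-⟶β : ∀ τ {t t'} → Red τ t → t ⟶β t' → Red τ t'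
  Red-⟶β (base a) (sn h) t⟶t'         = h t⟶t'
  Red-⟶β (A ⇒ τ)  r      t⟶t' u su ra = Red-⟶β τ (r u su ra) (ξ·₁ t⟶t')

  Redᴹ-⟶β : ∀ A {t t'} → Redᴹ A t → t ⟶β t' → Redᴹ A t'
  Redᴹ-⟶β []      _        _    = tt
  Redᴹ-⟶β (σ ∷ A) (r , rs) t⟶t' = Red-⟶β σ r t⟶t' , Redᴹ-⟶β A rs t⟶t'

-- Neutral terms are the non-abstractions: applying them creates no redex.
data Neutral : Term → Set where
  var : ∀ {n} → Neutral (var n)
  _·_ : ∀ t u → Neutral (t · u)

neutral-·-⟶β : ∀ {t u s} → Neutral t → t · u ⟶β s →
               (Σ Term λ t' → t ⟶β t' × s ≡ t' · u) ⊎ (Σ Term λ u' → u ⟶β u' × s ≡ t · u')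
neutral-·-⟶β () β
neutral-·-⟶β _  (ξ·₁ t⟶t') = inj₁ (_ , t⟶t' , refl)
neutral-·-⟶β _  (ξ·₂ u⟶u') = inj₂ (_ , u⟶u' , refl)

mutual
  Red-neutral : ∀ τ {t} → Neutral t → (∀ {t'} → t ⟶β t' → Red τ t') → Red τ t
  Red-neutral (base a) _  h = sn h
  Red-neutral (A ⇒ τ)  nt h = Red-neutral-· A τ nt h

  Red-neutral-· : ∀ A τ {t} → Neutral t → (∀ {t'} → t ⟶β t' → Red (A ⇒ τ) t') →
                  ∀ u → SN u → Redᴹ A u → Red τ (t · u)
  Red-neutral-· A τ {t} nt h u (sn hu) ra = Red-neutral τ (t · u) reducts
    where
    reducts : ∀ {s} → t · u ⟶β s → Red τ s
    reducts tu⟶s with neutral-·-⟶β nt tu⟶s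
    ... | inj₁ (_ , t⟶t' , refl) = h t⟶t' u (sn hu) ra
    ... | inj₂ (_ , u⟶u' , refl) = Red-neutral-· A τ nt h _ (hu u⟶u') (Redᴹ-⟶β A ra u⟶u')

Redᴹ-var : ∀ A n → Redᴹ A (var n)
Redᴹ-var []      n = tt
Redᴹ-var (σ ∷ A) n = Red-neutral σ var (λ ()) , Redᴹ-var A n

Red⇒SN : ∀ τ {t} → Red τ t → SN t
Red⇒SN (base a) r = r
Red⇒SN (A ⇒ τ)  r = SN-·ˡ (Red⇒SN τ (r (var 0) (SN-var 0) (Redᴹ-var A 0)))

Redᴹ⇒SN : ∀ A {u} → ¬ A ≡ [] → Redᴹ A u → SN u
Redᴹ⇒SN []      A≢[] _       = ⊥-elim (A≢[] refl)
Redᴹ⇒SN (σ ∷ A) _    (r , _) = Red⇒SN σ r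

Red-ƛ : ∀ τ A t → SN t → (∀ u → SN u → Redᴹ A u → Red τ (t [ u ])) → Red (A ⇒ τ) (ƛ t)
Red-ƛ τ A t (sn ht) red[] u (sn hu) ra = Red-neutral τ ((ƛ t) · u) reducts
  where
  reducts : ∀ {s} → (ƛ t) · u ⟶β s → Red τ s
  reducts β               = red[] u (sn hu) ra
  reducts (ξ·₁ (ξƛ t⟶t')) = Red-ƛ τ A _ (ht t⟶t')
    (λ u' su' ra' → Red-⟶β τ (red[] u' su' ra') (subst-⟶β (sub0 u') t⟶t')) u (sn hu) ra
  reducts (ξ·₂ u⟶u')      = Red-ƛ τ A t (sn ht) red[] _ (hu u⟶u') (Redᴹ-⟶β A ra u⟶u')

RedEnv : Env → (ℕ → Term) → Set
RedEnv Γ s = ∀ n → Redᴹ (lookupE Γ n) (s n)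

RedEnv-+E⁻ : ∀ Γ Δ {s} → RedEnv (Γ +E Δ) s → RedEnv Γ s × RedEnv Δ s
RedEnv-+E⁻ Γ Δ {s} rs = (proj₁ ∘ split) , (proj₂ ∘ split)
  where
  split : ∀ n → Redᴹ (lookupE Γ n) (s n) × Redᴹ (lookupE Δ n) (s n)
  split n = Redᴹ-++⁻ (lookupE Γ n) (transport (λ A → Redᴹ A (s n)) (lookupE-+E Γ Δ n) (rs n))

RedEnv-• : ∀ Γ {s u} → Redᴹ (headE Γ) u → RedEnv (tailE Γ) s → RedEnv Γ (u • s)
RedEnv-• Γ {u = u} ru rs zero    = transport (λ A → Redᴹ A u) (headE-lookupE Γ) ru
RedEnv-• Γ {s}     ru rs (suc n) = transport (λ A → Redᴹ A (s n)) (lookupE-tailE Γ n) (rs n)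

mutual
  fundamental : ∀ {Γ t τ} → Γ ⊢ t ∶ τ → ∀ s → RedEnv Γ s → Red τ (subst s t)
  fundamental (varw {n = n} ρ∈Γn) s rs = Redᴹ-∈ ρ∈Γn (rs n)
  fundamental (lam {Γ} {t} {τ} d) s rs =
    Red-ƛ τ (headE Γ) (subst (exts s) t) sn-body red[]
    where
    red[] : ∀ u → SN u → Redᴹ (headE Γ) u → Red τ (subst (exts s) t [ u ])
    red[] u _ ru = transport (Red τ) (sym (subst-exts-[] s t u))
                             (fundamental d (u • s) (RedEnv-• Γ ru rs))
    sn-body : SN (subst (exts s) t)
    sn-body = SN-[]⁻ _ (Red⇒SN τ (red[] (var 0) (SN-var 0) (Redᴹ-var _ 0)))
  fundamental (app≠ {Γ} {Δ} {u = u} {A} d dm A≈B A≢[]) s rs =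
    let rsΓ , rsΔ = RedEnv-+E⁻ Γ Δ rs
        ra        = from (Redᴹ-≈M A≈B) (fundamentalᴹ dm s rsΔ)
    in  fundamental d s rsΓ (subst s u) (Redᴹ⇒SN A A≢[] ra) ra
  fundamental (app[] {Γ} {Δ} {u = u} {σ} d dm) s rs =
    let rsΓ , rsΔ = RedEnv-+E⁻ Γ Δ rs
        rσ , _    = fundamentalᴹ dm s rsΔ
    in  fundamental d s rsΓ (subst s u) (Red⇒SN σ rσ) tt

  fundamentalᴹ : ∀ {Δ t B} → Δ ⊢m t ∶ B → ∀ s → RedEnv Δ s → Redᴹ B (subst s t)
  fundamentalᴹ mnil                 s rs = tt
  fundamentalᴹ (mcons {Γ} {Δ} d dm) s rs =
    let rsΓ , rsΔ = RedEnv-+E⁻ Γ Δ rs in fundamental d s rsΓ , fundamentalᴹ dm s rsΔ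

typable⇒SN : ∀ {Γ t σ} → Γ ⊢ t ∶ σ → SN t
typable⇒SN {Γ} {t} {σ} d =
  transport SN (subst-var t) (Red⇒SN σ (fundamental d var (λ n → Redᴹ-var (lookupE Γ n) n)))

-- Subject expansion

mutual
  ≈T-refl : ∀ σ → σ ≈T σ
  ≈T-refl (base a) = base
  ≈T-refl (A ⇒ σ)  = arr (≈M-refl A) (≈T-refl σ)

  ≈M-refl : ∀ A → A ≈M A
  ≈M-refl []      = []
  ≈M-refl (σ ∷ A) = ≈T-refl σ ∷ ≈M-refl A

TypableAt : Term → Ty → Set
TypableAt t σ = Σ Env λ Γ → Γ ⊢ t ∶ σ

All-TypableAt⇒⊢m : ∀ {u A} → All (TypableAt u) A → Σ Env λ Δ → Δ ⊢m u ∶ A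
All-TypableAt⇒⊢m []             = [] , mnil
All-TypableAt⇒⊢m ((Γ , d) ∷ ds) =
  let Δ , dm = All-TypableAt⇒⊢m ds in Γ +E Δ , mcons d dm

app-typable : ∀ {t u A τ σ} → TypableAt t (A ⇒ τ) → All (TypableAt u) A →
              TypableAt u σ → TypableAt (t · u) τ
app-typable {A = []}    (Γ , d) _  (Δ , du) = Γ +E (Δ +E []) , app[] d (mcons du mnil)
app-typable {A = _ ∷ _} (Γ , d) ds _        =
  let Δ , dm = All-TypableAt⇒⊢m ds in Γ +E Δ , app≠ d dm (≈M-refl _) λ ()

lam-at : ∀ {Γ t τ A} → headE Γ ≡ A → Γ ⊢ t ∶ τ → tailE Γ ⊢ ƛ t ∶ A ⇒ τ
lam-at refl d = lam d

infix 4 _≗[_]_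
record _≗[_]_ (Γ : Env) (f : ℕ → ℕ) (Γ' : Env) : Set where
  constructor along
  field lookupE-along : lookupE Γ ∘ f ≗ lookupE Γ'

-- wkAt i is the renaming that makes room for a fresh variable at index i.
wkAt : ℕ → ℕ → ℕ
wkAt zero    = suc
wkAt (suc i) = ext (wkAt i)

insertAt : ℕ → MTy → Env → Env
insertAt zero    A Γ = A ∷ Γ
insertAt (suc k) A Γ = headE Γ ∷ insertAt k A (tailE Γ)

removeAt : ℕ → Env → Env
removeAt zero    Γ = tailE Γ
removeAt (suc i) Γ = headE Γ ∷ removeAt i (tailE Γ)

lookupE-insertAt : ∀ k A Γ → lookupE (insertAt k A Γ) k ≡ A
lookupE-insertAt zero    A Γ = refl
lookupE-insertAt (suc k) A Γ = lookupE-insertAt k A (tailE Γ)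

lookupE-insertAt-wkAt : ∀ k A Γ → lookupE (insertAt k A Γ) ∘ wkAt k ≗ lookupE Γ
lookupE-insertAt-wkAt zero    A Γ n       = refl
lookupE-insertAt-wkAt (suc k) A Γ zero    = headE-lookupE Γ
lookupE-insertAt-wkAt (suc k) A Γ (suc n) =
  ≡.trans (lookupE-insertAt-wkAt k A (tailE Γ) n) (lookupE-tailE Γ n)

lookupE-removeAt : ∀ i Γ → lookupE Γ ∘ wkAt i ≗ lookupE (removeAt i Γ)
lookupE-removeAt zero    Γ n       = sym (lookupE-tailE Γ n)
lookupE-removeAt (suc i) Γ zero    = sym (headE-lookupE Γ)
lookupE-removeAt (suc i) Γ (suc n) =
  ≡.trans (sym (lookupE-tailE Γ (wkAt i n))) (lookupE-removeAt i (tailE Γ) n)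

module _ {f : ℕ → ℕ} where

  +E-∘ : ∀ {Γ Γ' Δ Δ'} → Γ ≗[ f ] Γ' → Δ ≗[ f ] Δ' → Γ +E Δ ≗[ f ] Γ' +E Δ'
  +E-∘ {Γ} {Γ'} {Δ} {Δ'} (along Γf≗Γ') (along Δf≗Δ') = along λ n → begin
    lookupE (Γ +E Δ) (f n)              ≡⟨ lookupE-+E Γ Δ (f n) ⟩
    lookupE Γ (f n) ++ lookupE Δ (f n)  ≡⟨ cong₂ _++_ (Γf≗Γ' n) (Δf≗Δ' n) ⟩
    lookupE Γ' n ++ lookupE Δ' n        ≡⟨ sym (lookupE-+E Γ' Δ' n) ⟩
    lookupE (Γ' +E Δ') n                ∎
    where open ≡-Reasoning

  headE-∘ext : ∀ {Γ Γ'} → Γ ≗[ ext f ] Γ' → headE Γ ≡ headE Γ'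
  headE-∘ext {Γ} {Γ'} (along Γf≗Γ') =
    ≡.trans (headE-lookupE Γ) (≡.trans (Γf≗Γ' 0) (sym (headE-lookupE Γ')))

  tailE-∘ext : ∀ {Γ Γ'} → Γ ≗[ ext f ] Γ' → tailE Γ ≗[ f ] tailE Γ'
  tailE-∘ext {Γ} {Γ'} (along Γf≗Γ') = along λ n →
    ≡.trans (lookupE-tailE Γ (f n)) (≡.trans (Γf≗Γ' (suc n)) (sym (lookupE-tailE Γ' n)))

Strengthened : ℕ → Env → (Env → Set) → Set
Strengthened i Γ J = Σ Env λ Γ' → Γ ≗[ wkAt i ] Γ' × J Γ'

mutual
  strengthen : ∀ i t {Γ ρ} → Γ ⊢ rename (wkAt i) t ∶ ρ → Strengthened i Γ (_⊢ t ∶ ρ)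
  strengthen i (var n) {Γ} (varw ρ∈Γ) =
    removeAt i Γ , along (lookupE-removeAt i Γ) , varw (transport (_ ∈_) (lookupE-removeAt i Γ n) ρ∈Γ)
  strengthen i (ƛ t) (lam d) =
    let Γ' , rel , d' = strengthen (suc i) t d
    in  tailE Γ' , tailE-∘ext rel , lam-at (sym (headE-∘ext rel)) d'
  strengthen i (t · u) (app≠ d dm A≈B A≢[]) =
    let Γ' , relΓ , d' = strengthen i t d ; Δ' , relΔ , dm' = strengthenᴹ i u dm
    in  Γ' +E Δ' , +E-∘ relΓ relΔ , app≠ d' dm' A≈B A≢[]
  strengthen i (t · u) (app[] d dm) =
    let Γ' , relΓ , d' = strengthen i t d ; Δ' , relΔ , dm' = strengthenᴹ i u dm
    in  Γ' +E Δ' , +E-∘ relΓ relΔ , app[] d' dm'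

  strengthenᴹ : ∀ i t {Γ B} → Γ ⊢m rename (wkAt i) t ∶ B → Strengthened i Γ (_⊢m t ∶ B)
  strengthenᴹ i t mnil         = [] , along (λ _ → refl) , mnil
  strengthenᴹ i t (mcons d dm) =
    let Γ' , relΓ , d' = strengthen i t d ; Δ' , relΔ , dm' = strengthenᴹ i t dm
    in  Γ' +E Δ' , +E-∘ relΓ relΔ , mcons d' dm'

extsⁿ : ℕ → (ℕ → Term) → ℕ → Term
extsⁿ zero    s = s
extsⁿ (suc k) s = exts (extsⁿ k s)

-- Γ₀ types the term before substituting c for the variable k, which Γ₀ gives
-- exactly the types at which c occurs.
Unsubstituted : Term → ℕ → Env → (Env → Set) → Set
Unsubstituted c k Γ J =
  Σ Env λ Γ₀ → Γ₀ ≗[ wkAt k ] Γ × All (TypableAt c) (lookupE Γ₀ k) × J Γ₀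

All-lookupE-+E : ∀ {P : Ty → Set} Γ Δ k → All P (lookupE Γ k) → All P (lookupE Δ k) →
                 All P (lookupE (Γ +E Δ) k)
All-lookupE-+E {P} Γ Δ k pΓ pΔ = transport (All P) (sym (lookupE-+E Γ Δ k)) (++⁺ pΓ pΔ)

unsubstitute-var : ∀ c k m {Γ ρ} → Γ ⊢ extsⁿ k (sub0 c) m ∶ ρ → Unsubstituted c k Γ (_⊢ var m ∶ ρ)
unsubstitute-var c zero zero {Γ} {ρ} d =
  insertAt 0 (ρ ∷ []) Γ , along (λ _ → refl) , (Γ , d) ∷ [] , varw (here refl)
unsubstitute-var c zero (suc m) {Γ} (varw ρ∈Γ) =
  insertAt 0 [] Γ , along (λ _ → refl) , [] , varw ρ∈Γ
unsubstitute-var c (suc k) zero {Γ} (varw ρ∈Γ) =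
  insertAt (suc k) [] Γ , along (lookupE-insertAt-wkAt (suc k) [] Γ) ,
  transport (All _) (sym (lookupE-insertAt k [] (tailE Γ))) [] ,
  varw (transport (_ ∈_) (sym (lookupE-insertAt-wkAt (suc k) [] Γ 0)) ρ∈Γ)
unsubstitute-var c (suc k) (suc m) {Γ} d
  with strengthen 0 (extsⁿ k (sub0 c) m) d
... | Γ' , along relΓ' , d' with unsubstitute-var c k m d'
... | Γ₀ , along rel , args , varw ρ∈Γ₀ = headE Γ ∷ Γ₀ , along rel' , args , varw ρ∈Γ₀
  where
  rel' : lookupE (headE Γ ∷ Γ₀) ∘ wkAt (suc k) ≗ lookupE Γ
  rel' zero    = headE-lookupE Γ
  rel' (suc n) = ≡.trans (rel n) (sym (relΓ' n))

mutual
  unsubstitute : ∀ c k b {Γ ρ} → Γ ⊢ subst (extsⁿ k (sub0 c)) b ∶ ρ →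
                 Unsubstituted c k Γ (_⊢ b ∶ ρ)
  unsubstitute c k (var m) d = unsubstitute-var c k m d
  unsubstitute c k (ƛ b) (lam d) =
    let Γ₀ , rel , args , d₀ = unsubstitute c (suc k) b d
    in  tailE Γ₀ , tailE-∘ext rel , transport (All _) (sym (lookupE-tailE Γ₀ k)) args ,
        lam-at (headE-∘ext rel) d₀
  unsubstitute c k (b · b') (app≠ d dm A≈B A≢[]) =
    let Γ₀ , relΓ , argsΓ , d₀ = unsubstitute c k b d
        Δ₀ , relΔ , argsΔ , dm₀ = unsubstituteᴹ c k b' dm
    in  Γ₀ +E Δ₀ , +E-∘ relΓ relΔ , All-lookupE-+E Γ₀ Δ₀ k argsΓ argsΔ , app≠ d₀ dm₀ A≈B A≢[]
  unsubstitute c k (b · b') (app[] d dm) =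
    let Γ₀ , relΓ , argsΓ , d₀ = unsubstitute c k b d
        Δ₀ , relΔ , argsΔ , dm₀ = unsubstituteᴹ c k b' dm
    in  Γ₀ +E Δ₀ , +E-∘ relΓ relΔ , All-lookupE-+E Γ₀ Δ₀ k argsΓ argsΔ , app[] d₀ dm₀

  unsubstituteᴹ : ∀ c k b {Γ B} → Γ ⊢m subst (extsⁿ k (sub0 c)) b ∶ B →
                  Unsubstituted c k Γ (_⊢m b ∶ B)
  unsubstituteᴹ c k b mnil = [] , along (λ _ → refl) , [] , mnil
  unsubstituteᴹ c k b (mcons d dm) =
    let Γ₀ , relΓ , argsΓ , d₀ = unsubstitute c k b d
        Δ₀ , relΔ , argsΔ , dm₀ = unsubstituteᴹ c k b dm
    in  Γ₀ +E Δ₀ , +E-∘ relΓ relΔ , All-lookupE-+E Γ₀ Δ₀ k argsΓ argsΔ , mcons d₀ dm₀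

infix 4 _≼_
_≼_ : Term → Term → Set
s ≼ t = ∀ {ρ} → TypableAt s ρ → TypableAt t ρ

subject-expansion : ∀ {b c σ} → TypableAt c σ → b [ c ] ≼ (ƛ b) · c
subject-expansion {b} {c} tc (Γ , d) =
  let Γ₀ , _ , args , d₀ = unsubstitute c 0 b d
  in  app-typable (tailE Γ₀ , lam d₀) (transport (All _) (sym (headE-lookupE Γ₀)) args) tc

≼-·ˡ : ∀ {s t} → s ≼ t → ∀ a → s · a ≼ t · a
≼-·ˡ s≼t a (_ , app≠ d dm A≈B A≢[]) = _ , app≠ (proj₂ (s≼t (_ , d))) dm A≈B A≢[]
≼-·ˡ s≼t a (_ , app[] d dm)         = _ , app[] (proj₂ (s≼t (_ , d))) dm

-- Completeness

var-typable : ∀ n σ → TypableAt (var n) σ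
var-typable n σ =
  insertAt n (σ ∷ []) [] , varw (transport (σ ∈_) (sym (lookupE-insertAt n (σ ∷ []) [])) (here refl))

infix 4 _⊴_
data _⊴_ : Term → Term → Set where
  ⊴-refl : ∀ {t}     → t ⊴ t
  ⊴-ƛ    : ∀ {s t}   → s ⊴ t → s ⊴ ƛ t
  ⊴-·ˡ   : ∀ {s t u} → s ⊴ t → s ⊴ t · u
  ⊴-·ʳ   : ∀ {s t u} → s ⊴ u → s ⊴ t · u

⊴-trans : ∀ {r s t} → r ⊴ s → s ⊴ t → r ⊴ t
⊴-trans r⊴s ⊴-refl      = r⊴s
⊴-trans r⊴s (⊴-ƛ s⊴t)  = ⊴-ƛ (⊴-trans r⊴s s⊴t)
⊴-trans r⊴s (⊴-·ˡ s⊴t) = ⊴-·ˡ (⊴-trans r⊴s s⊴t)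
⊴-trans r⊴s (⊴-·ʳ s⊴t) = ⊴-·ʳ (⊴-trans r⊴s s⊴t)

⊴-ƛ⁻ : ∀ {a t} → ƛ a ⊴ t → a ⊴ t
⊴-ƛ⁻ = ⊴-trans (⊴-ƛ ⊴-refl)

⊴-·ˡ⁻ : ∀ {f a t} → f · a ⊴ t → f ⊴ t
⊴-·ˡ⁻ = ⊴-trans (⊴-·ˡ ⊴-refl)

⊴-·ʳ⁻ : ∀ {f a t} → f · a ⊴ t → a ⊴ t
⊴-·ʳ⁻ = ⊴-trans (⊴-·ʳ ⊴-refl)

⊴-⟶β : ∀ {s t s'} → s ⊴ t → s ⟶β s' → Σ Term λ t' → t ⟶β t' × s' ⊴ t'
⊴-⟶β ⊴-refl   s⟶s' = _ , s⟶s' , ⊴-refl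
⊴-⟶β (⊴-ƛ p)  s⟶s' = let t' , t⟶t' , q = ⊴-⟶β p s⟶s' in ƛ t' , ξƛ t⟶t' , ⊴-ƛ q
⊴-⟶β (⊴-·ˡ p) s⟶s' = let t' , t⟶t' , q = ⊴-⟶β p s⟶s' in _ , ξ·₁ t⟶t' , ⊴-·ˡ q
⊴-⟶β (⊴-·ʳ p) s⟶s' = let t' , t⟶t' , q = ⊴-⟶β p s⟶s' in _ , ξ·₂ t⟶t' , ⊴-·ʳ q

-- An application either has a variable at its head, or a head redex.
data HeadView (s : Term) : Set where
  rigid : (∀ τ → TypableAt s τ) → HeadView s
  redex : ∀ {s'} → s ⟶β s' → s' ≼ s → HeadView s

module Completeness {t : Term}
  (typable-reduct : ∀ {t'} → t ⟶β t' → ∀ {s} → s ⊴ t' → Σ Ty (TypableAt s)) where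

  mutual
    typable : ∀ s → s ⊴ t → Σ Ty (TypableAt s)
    typable (var n) _ = base 0 , var-typable n (base 0)
    typable (ƛ a)   p =
      let σ , Γ , d = typable a (⊴-ƛ⁻ p) in headE Γ ⇒ σ , tailE Γ , lam d
    typable (f · a) p with head-view f a p
    ... | rigid typable-at = base 0 , typable-at (base 0)
    ... | redex s⟶s' s'≼s =
      let t' , t⟶t' , s'⊴t' = ⊴-⟶β p s⟶s' ; σ , ts' = typable-reduct t⟶t' s'⊴t'
      in  σ , s'≼s ts'

    head-view : ∀ f a → f · a ⊴ t → HeadView (f · a)
    head-view (var n) a p =
      let σ , ta = typable a (⊴-·ʳ⁻ p)
      in  rigid λ τ → app-typable (var-typable n ((σ ∷ []) ⇒ τ)) (ta ∷ []) ta
    head-view (ƛ b) a p = redex β (subject-expansion (proj₂ (typable a (⊴-·ʳ⁻ p))))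
    head-view (f · g) a p with head-view f g (⊴-·ˡ⁻ p)
    ... | redex s⟶s' s'≼s = redex (ξ·₁ s⟶s') (≼-·ˡ s'≼s a)
    ... | rigid typable-at =
      let σ , ta = typable a (⊴-·ʳ⁻ p)
      in  rigid λ τ → app-typable (typable-at ((σ ∷ []) ⇒ τ)) (ta ∷ []) ta

SN⇒typable-subterms : ∀ {t} → SN t → ∀ {s} → s ⊴ t → Σ Ty (TypableAt s)
SN⇒typable-subterms (sn h) {s} = Completeness.typable (λ t⟶t' → SN⇒typable-subterms (h t⟶t')) s

proposition4p9 : (t : Term) → (Σ Env λ Γ → Σ Ty λ σ → Γ ⊢ t ∶ σ) ⇔ SN t
proposition4p9 t = mk⇔
  (λ (_ , _ , d) → typable⇒SN d)
  (λ sn-t → let σ , Γ , d = SN⇒typable-subterms sn-t ⊴-refl in Γ , σ , d)
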